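{- Every module-composed graph is HHDS-free, i.e. contains no house, no hole, no domino and no sun as an induced subgraph.
   Context: All graphs are finite, simple and undirected. For a graph $G=(V_G,E_G)$ and $v\in V_G$, $N(v)=\{w\in V_G : \{v,w\}\in E_G\}$. A set $M\subseteq V_G$ is a module of $G$ if for all $v_1,v_2\in M$ we have $N(v_1)\setminus M=N(v_2)\setminus M$ (in particular the empty set, singletons and $V_G$ are modules). For $U\subseteq V_G$, $G[U]$ is the induced subgraph on $U$. A graph $G$ is module-composed if there is a bijection $\varphi:V_G\to\{1,\ldots,|V_G|\}$ such that for every $2\le i\le |V_G|$ the neighbourhood of $\varphi^{ -1}(i)$ in the graph $G[\{\varphi^{ -1}(1),\ldots,\varphi^{ -1}(i-1)\}]$ is a module of that graph. A hole is a chordless cycle on at least five vertices. The house is the complement of the path $P_5$ (a 4-cycle plus a vertex adjacent to exactly two adjacent vertices of the cycle). The domino is the graph on vertices $a_1,a_2,a_3,b_1,b_2,b_3$ with edges $a_1a_2,a_2a_3,b_1b_2,b_2b_3,a_1b_1,a_2b_2,a_3b_3$. For $k\ge 3$, a $k$-sun is a chordal graph on $2k$ vertices whose vertex set partitions into $U=\{u_0,\ldots,u_{k-1}\}$ and an independent set $W=\{w_0,\ldots,w_{k-1}\}$ such that $u_i$ is adjacent to $w_j$ iff $i=j$ or $i\equiv j+1 \pmod k$; a sun is a $k$-sun for some $k\ge3$. -}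

module Defs where

open import Data.Nat using (ℕ; zero; suc; _≡ᵇ_; _<_; _≤_)
open import Data.Fin using (Fin; toℕ)
open import Data.Bool using (Bool; true; false; _∨_; _∧_; if_then_else_)
open import Data.List using (List; []; _∷_)
open import Data.Bool.ListAction using (any)
open import Data.Product using (Σ; _×_; _,_; ∃-syntax)
open import Data.Sum using (_⊎_; inj₁; inj₂)
open import Relation.Nullary using (¬_)
open import Relation.Binary.PropositionalEquality using (_≡_)
open import Function.Bundles using (_⤖_; Bijection)
open import Function.Definitions using (Injective)

record Graph : Set where
  field
    n      : ℕ
    adj    : Fin n → Fin n → Bool
    sym    : ∀ x y → adj x y ≡ adj y x
    irrefl : ∀ x → adj x x ≡ false

open Graph public

Adj : (G : Graph) → Fin (n G) → Fin (n G) → Set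
Adj G x y = adj G x y ≡ true

-- M is a module of the induced subgraph G[U] (M ⊆ U assumed by the caller):
-- for all v1, v2 ∈ M, N(v1) \ M = N(v2) \ M, neighbourhoods taken in G[U].
IsModuleOf : (G : Graph) → (U M : Fin (n G) → Set) → Set
IsModuleOf G U M =
  ∀ v₁ v₂ → M v₁ → M v₂ →
  ∀ w → U w → ¬ M w → (Adj G v₁ w → Adj G v₂ w) × (Adj G v₂ w → Adj G v₁ w)

-- Module-composed: a bijection φ : V → {1..|V|} (here Fin n, 0-based) such
-- that for each vertex x, its neighbourhood in the graph induced by the
-- vertices strictly preceding x is a module of that induced graph.
ModuleComposed : Graph → Set
ModuleComposed G =
  Σ (Fin (n G) ⤖ Fin (n G)) λ φ →
    let pos = λ v → toℕ (Bijection.to φ v)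
        Before = λ x v → pos v < pos x
    in ∀ x → IsModuleOf G (Before x) (λ v → Before x v × Adj G x v)

ContainsInduced : {V : Set} → (V → V → Bool) → Graph → Set
ContainsInduced {V} h G =
  Σ (V → Fin (n G)) λ f → Injective _≡_ _≡_ f × (∀ a b → h a b ≡ adj G (f a) (f b))

next : ℕ → ℕ → ℕ
next k i = if suc i ≡ᵇ k then 0 else suc i

cycleAdj : (k : ℕ) → Fin k → Fin k → Bool
cycleAdj k i j = (next k (toℕ i) ≡ᵇ toℕ j) ∨ (next k (toℕ j) ≡ᵇ toℕ i)

edgeAdj : {m : ℕ} → List (ℕ × ℕ) → Fin m → Fin m → Bool
edgeAdj es i j = any (λ { (a , b) → ((a ≡ᵇ toℕ i) ∧ (b ≡ᵇ toℕ j)) ∨ ((a ≡ᵇ toℕ j) ∧ (b ≡ᵇ toℕ i)) }) es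

houseAdj : Fin 5 → Fin 5 → Bool
houseAdj = edgeAdj ((0 , 1) ∷ (1 , 2) ∷ (2 , 3) ∷ (3 , 0) ∷ (4 , 0) ∷ (4 , 1) ∷ [])

-- domino: a₁,a₂,a₃ = 0,1,2 ; b₁,b₂,b₃ = 3,4,5
dominoAdj : Fin 6 → Fin 6 → Bool
dominoAdj = edgeAdj ((0 , 1) ∷ (1 , 2) ∷ (3 , 4) ∷ (4 , 5) ∷ (0 , 3) ∷ (1 , 4) ∷ (2 , 5) ∷ [])

Chordal : {V : Set} → (V → V → Bool) → Set
Chordal {V} h =
  ∀ (m : ℕ) → 4 ≤ m →
  ¬ (Σ (Fin m → V) λ f → Injective _≡_ _≡_ f × (∀ a b → cycleAdj m a b ≡ h (f a) (f b)))

-- k-sun pattern with vertex set U ⊎ W (U = inj₁, W = inj₂);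
-- the adjacency inside U is an arbitrary relation hU;
-- W is independent; u_i ~ w_j iff i = j or i ≡ j+1 (mod k).
sunAdj : (k : ℕ) → (Fin k → Fin k → Bool) → Fin k ⊎ Fin k → Fin k ⊎ Fin k → Bool
sunAdj k hU (inj₁ i) (inj₁ j) = hU i j
sunAdj k hU (inj₂ i) (inj₂ j) = false
sunAdj k hU (inj₁ i) (inj₂ j) = (toℕ i ≡ᵇ toℕ j) ∨ (toℕ i ≡ᵇ next k (toℕ j))
sunAdj k hU (inj₂ j) (inj₁ i) = (toℕ i ≡ᵇ toℕ j) ∨ (toℕ i ≡ᵇ next k (toℕ j))

HHDSFree : Graph → Set
HHDSFree G =
  ¬ ContainsInduced houseAdj G
  × (∀ k → 5 ≤ k → ¬ ContainsInduced (cycleAdj k) G)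
  × ¬ ContainsInduced dominoAdj G
  × (∀ k → 3 ≤ k → ∀ (hU : Fin k → Fin k → Bool) →
       Chordal (sunAdj k hU) → ¬ ContainsInduced (sunAdj k hU) G)

module Submission where

-- Fix a module-composing order φ of G and an induced copy of a pattern
-- graph H in G.  The vertex a of H whose image comes last in φ sees all other
-- vertices of the copy before it, so its neighbourhood in H - a is a module of
-- H - a (being a module is inherited by induced subgraphs).  Hence H cannot
-- occur if every vertex a of H is *obstructed*: it has neighbours b₁, b₂ and a
-- vertex c ∉ N[a] such that c is adjacent to b₁ but not to b₂.

open import Defs hiding (sym)
open import Data.Nat using (ℕ; zero; suc; _+_; _∸_; _≡ᵇ_; _<_; _≤_; z≤n; z<s; s<s; s≤s; NonZero; _%_)
open import Data.Nat.Properties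
open import Data.Nat.DivMod using (m%n<n; m<n⇒m%n≡m; n%n≡0; m%n%n≡m%n; %-distribˡ-+; %-congˡ; [m+n]%n≡m%n; m≤n⇒[n∸m]%m≡n%m)
open import Data.Fin using (Fin; toℕ; fromℕ<; #_) renaming (zero to fzero; suc to fsuc)
open import Data.Fin.Properties using (toℕ-injective; toℕ-fromℕ<; toℕ<n)
open import Data.Unit using (tt)
open import Data.Bool using (Bool; true; false; _∨_; T)
open import Data.Bool.Properties using (∨-zeroʳ)
open import Data.Product using (Σ; _×_; _,_; proj₁; proj₂)
open import Data.Sum using (_⊎_; inj₁; inj₂)
open import Data.Sum.Properties using (inj₁-injective; inj₂-injective)
open import Relation.Nullary using (¬_; yes; no)
open import Relation.Nullary.Decidable using (dec-true; dec-false)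
open import Relation.Binary.PropositionalEquality
open import Function using (_∘_)
open import Function.Bundles using (Bijection)

HasMaxima : Set → Set
HasMaxima V = (g : V → ℕ) → Σ V λ a → ∀ b → g b ≤ g a

maxima-Fin : ∀ k → HasMaxima (Fin (suc k))
maxima-Fin zero    g = fzero , λ { fzero → ≤-refl }
maxima-Fin (suc k) g with maxima-Fin k (g ∘ fsuc)
... | a , a-max with ≤-total (g fzero) (g (fsuc a))
...   | inj₁ g0≤ga = fsuc a , λ { fzero → g0≤ga ; (fsuc i) → a-max i }
...   | inj₂ ga≤g0 = fzero  , λ { fzero → ≤-refl ; (fsuc i) → ≤-trans (a-max i) ga≤g0 }

maxima-⊎ : {A B : Set} → HasMaxima A → HasMaxima B → HasMaxima (A ⊎ B)
maxima-⊎ maxA maxB g with maxA (g ∘ inj₁) | maxB (g ∘ inj₂)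
... | a , a-max | b , b-max with ≤-total (g (inj₁ a)) (g (inj₂ b))
...   | inj₁ ga≤gb = inj₂ b , λ { (inj₁ x) → ≤-trans (a-max x) ga≤gb ; (inj₂ x) → b-max x }
...   | inj₂ gb≤ga = inj₁ a , λ { (inj₁ x) → a-max x ; (inj₂ x) → ≤-trans (b-max x) gb≤ga }

NeighbourhoodIsModule : {V : Set} → (V → V → Bool) → V → Set
NeighbourhoodIsModule h a =
  ∀ b₁ b₂ c → h a b₁ ≡ true → h a b₂ ≡ true → h a c ≡ false → c ≢ a →
  h b₁ c ≡ true → h b₂ c ≡ true

record Obstruction {V : Set} (h : V → V → Bool) (a : V) : Set where
  constructor obstruction
  field
    b₁ b₂ c : V
    a~b₁ : h a b₁ ≡ true
    a~b₂ : h a b₂ ≡ true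
    a≁c  : h a c ≡ false
    c≢a  : c ≢ a
    b₁~c : h b₁ c ≡ true
    b₂≁c : h b₂ c ≡ false

obstruction-breaks-module : {V : Set} {h : V → V → Bool} {a : V} →
                            Obstruction h a → ¬ NeighbourhoodIsModule h a
obstruction-breaks-module (obstruction b₁ b₂ c a~b₁ a~b₂ a≁c c≢a b₁~c b₂≁c) modular
  with trans (sym (modular b₁ b₂ c a~b₁ a~b₂ a≁c c≢a b₁~c)) b₂≁c
... | ()

last-vertex-modular : (G : Graph) → ModuleComposed G →
                      {V : Set} {h : V → V → Bool} → HasMaxima V →
                      ContainsInduced h G → Σ V (NeighbourhoodIsModule h)
last-vertex-modular G (φ , composed) {h = h} maxima (f , f-injective , f-induced) =
  a , modular
  where
  pos : Fin (n G) → ℕ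
  pos v = toℕ (Bijection.to φ v)

  a : _
  a = proj₁ (maxima (pos ∘ f))

  precedes : ∀ b → b ≢ a → pos (f b) < pos (f a)
  precedes b b≢a = ≤∧≢⇒< (proj₂ (maxima (pos ∘ f)) b)
    (λ e → b≢a (f-injective (Bijection.injective φ (toℕ-injective e))))

  edge : ∀ {x y} → h x y ≡ true → Adj G (f x) (f y)
  edge {x} {y} x~y = trans (sym (f-induced x y)) x~y

  -- the pattern is loopless because G is
  neighbour≢ : ∀ {b} → h a b ≡ true → b ≢ a
  neighbour≢ a~b refl with trans (sym a~b) (trans (f-induced a a) (irrefl G (f a)))
  ... | ()

  modular : NeighbourhoodIsModule h a
  modular b₁ b₂ c a~b₁ a~b₂ a≁c c≢a b₁~c =
    trans (f-induced b₂ c)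
      (proj₁ (composed (f a) (f b₁) (f b₂)
                (precedes b₁ (neighbour≢ a~b₁) , edge a~b₁)
                (precedes b₂ (neighbour≢ a~b₂) , edge a~b₂)
                (f c) (precedes c c≢a) c∉N[a])
        (edge b₁~c))
    where
    c∉N[a] : ¬ (pos (f c) < pos (f a) × Adj G (f a) (f c))
    c∉N[a] (_ , fa~fc) with trans (sym fa~fc) (trans (sym (f-induced a c)) a≁c)
    ... | ()

obstructed-pattern-free : (G : Graph) → ModuleComposed G →
                          {V : Set} {h : V → V → Bool} → HasMaxima V →
                          (∀ a → Obstruction h a) → ¬ ContainsInduced h G
obstructed-pattern-free G mc maxima obstructed copy
  with last-vertex-modular G mc maxima copy
... | a , modular = obstruction-breaks-module (obstructed a) modular

house-obstructed : (a : Fin 5) → Obstruction houseAdj a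
house-obstructed fzero = obstruction (# 1) (# 4) (# 2) refl refl refl (λ ()) refl refl
house-obstructed (fsuc fzero) = obstruction (# 0) (# 4) (# 3) refl refl refl (λ ()) refl refl
house-obstructed (fsuc (fsuc fzero)) = obstruction (# 1) (# 3) (# 4) refl refl refl (λ ()) refl refl
house-obstructed (fsuc (fsuc (fsuc fzero))) = obstruction (# 0) (# 2) (# 4) refl refl refl (λ ()) refl refl
house-obstructed (fsuc (fsuc (fsuc (fsuc fzero)))) = obstruction (# 0) (# 1) (# 3) refl refl refl (λ ()) refl refl

domino-obstructed : (a : Fin 6) → Obstruction dominoAdj a
domino-obstructed fzero = obstruction (# 1) (# 3) (# 2) refl refl refl (λ ()) refl refl
domino-obstructed (fsuc fzero) = obstruction (# 0) (# 2) (# 3) refl refl refl (λ ()) refl refl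
domino-obstructed (fsuc (fsuc fzero)) = obstruction (# 1) (# 5) (# 0) refl refl refl (λ ()) refl refl
domino-obstructed (fsuc (fsuc (fsuc fzero))) = obstruction (# 4) (# 0) (# 5) refl refl refl (λ ()) refl refl
domino-obstructed (fsuc (fsuc (fsuc (fsuc fzero)))) = obstruction (# 3) (# 5) (# 0) refl refl refl (λ ()) refl refl
domino-obstructed (fsuc (fsuc (fsuc (fsuc (fsuc fzero))))) = obstruction (# 4) (# 2) (# 3) refl refl refl (λ ()) refl refl

∨-trueˡ : ∀ {x y} → x ≡ true → (x ∨ y) ≡ true
∨-trueˡ refl = refl

∨-trueʳ : ∀ {x y} → y ≡ true → (x ∨ y) ≡ true
∨-trueʳ {x} refl = ∨-zeroʳ x

∨-false : ∀ {x y} → x ≡ false → y ≡ false → (x ∨ y) ≡ false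
∨-false refl refl = refl

next-residue : ∀ {k r} .{{_ : NonZero k}} → r < k → next k r ≡ suc r % k
next-residue {k} {r} r<k with suc r ≡ᵇ k in wraps
... | true  = sym (trans (%-congˡ (≡ᵇ⇒≡ (suc r) k (subst T (sym wraps) tt))) (n%n≡0 k))
... | false = sym (m<n⇒m%n≡m (≤∧≢⇒< r<k (λ e → subst T wraps (≡⇒≡ᵇ (suc r) k e))))

%-reduceˡ : ∀ x d {k} .{{_ : NonZero k}} → (x % k + d) % k ≡ (x + d) % k
%-reduceˡ x d {k} = begin
  (x % k + d) % k            ≡⟨ %-distribˡ-+ (x % k) d k ⟩
  (x % k % k + d % k) % k    ≡⟨ cong (λ r → (r + d % k) % k) (m%n%n≡m%n x k) ⟩
  (x % k + d % k) % k        ≡⟨ sym (%-distribˡ-+ x d k) ⟩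
  (x + d) % k                ∎
  where open ≡-Reasoning

shift-moves : ∀ {k r d} .{{_ : NonZero k}} → r < k → 0 < d → d < k → (r + d) % k ≢ r
shift-moves {k} {r} {d} r<k 0<d d<k e with r + d <? k
... | yes r+d<k = <⇒≢ (m<m+n r 0<d) (sym (trans (sym (m<n⇒m%n≡m r+d<k)) e))
... | no  r+d≮k = <⇒≢ d<k (+-cancelˡ-≡ r d k once-around)
  where
  k≤r+d : k ≤ r + d
  k≤r+d = ≮⇒≥ r+d≮k

  -- after wrapping once, r + d lands on r + d ∸ k, which must then be r
  wrapped : r + d ∸ k ≡ r
  wrapped = begin
    r + d ∸ k            ≡⟨ sym (m<n⇒m%n≡m (m<n+o⇒m∸n<o (r + d) k (+-mono-< r<k d<k))) ⟩
    (r + d ∸ k) % k      ≡⟨ m≤n⇒[n∸m]%m≡n%m k≤r+d ⟩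
    (r + d) % k          ≡⟨ e ⟩
    r                    ∎
    where open ≡-Reasoning

  once-around : r + d ≡ r + k
  once-around = trans (sym (m∸n+n≡m k≤r+d)) (cong (_+ k) wrapped)

module CyclicWalk (k : ℕ) .{{_ : NonZero k}} (y : ℕ) where

  vertex : ℕ → Fin k
  vertex j = fromℕ< (m%n<n (y + j) k)

  pos : ℕ → ℕ
  pos j = toℕ (vertex j)

  pos-residue : ∀ j → pos j ≡ (y + j) % k
  pos-residue j = toℕ-fromℕ< (m%n<n (y + j) k)

  pos-shift : ∀ i d → pos (i + d) ≡ (pos i + d) % k
  pos-shift i d = begin
    pos (i + d)            ≡⟨ pos-residue (i + d) ⟩
    (y + (i + d)) % k      ≡⟨ cong (_% k) (sym (+-assoc y i d)) ⟩
    (y + i + d) % k        ≡⟨ sym (%-reduceˡ (y + i) d) ⟩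
    ((y + i) % k + d) % k  ≡⟨ cong (λ r → (r + d) % k) (sym (pos-residue i)) ⟩
    (pos i + d) % k        ∎
    where open ≡-Reasoning

  next-pos : ∀ j → next k (pos j) ≡ pos (j + 1)
  next-pos j = begin
    next k (pos j)   ≡⟨ next-residue (toℕ<n (vertex j)) ⟩
    suc (pos j) % k  ≡⟨ cong (_% k) (+-comm 1 (pos j)) ⟩
    (pos j + 1) % k  ≡⟨ sym (pos-shift j 1) ⟩
    pos (j + 1)      ∎
    where open ≡-Reasoning

  pos-injective : ∀ {i j} → i < j → j < i + k → pos i ≢ pos j
  pos-injective {i} i<j j<i+k e with o , refl ← m≤n⇒∃[o]m+o≡n i<j =
    shift-moves (toℕ<n (vertex i)) z<s o<k
      (trans (sym (pos-shift i (suc o))) (trans (cong pos (+-suc i o)) (sym e)))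
    where
    o<k : suc o < k
    o<k = +-cancelˡ-< i (suc o) k (subst (_< i + k) (sym (+-suc i o)) j<i+k)

  cycle-step : ∀ j → cycleAdj k (vertex j) (vertex (j + 1)) ≡ true
  cycle-step j = ∨-trueˡ (dec-true (_ ≟ _) (next-pos j))

  cycle-step-back : ∀ j → cycleAdj k (vertex (j + 1)) (vertex j) ≡ true
  cycle-step-back j = ∨-trueʳ (dec-true (_ ≟ _) (next-pos j))

  cycle-gap : ∀ {i j} → i + 1 < j → j + 1 < i + k → cycleAdj k (vertex j) (vertex i) ≡ false
  cycle-gap {i} {j} i+1<j j+1<i+k =
    ∨-false (dec-false (_ ≟ _) (λ e → pos-injective i<j+1 j+1<i+k (sym (trans (sym (next-pos j)) e))))
            (dec-false (_ ≟ _) (λ e → pos-injective i+1<j j<i+1+k (trans (sym (next-pos i)) e)))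
    where
    i<j+1 : i < j + 1
    i<j+1 = <-trans (m<m+n i z<s) (<-trans i+1<j (m<m+n j z<s))
    j<i+1+k : j < i + 1 + k
    j<i+1+k = <-trans (m<m+n j z<s) (<-≤-trans j+1<i+k (+-monoˡ-≤ k (m≤m+n i 1)))

  module _ (hU : Fin k → Fin k → Bool) where

    sun-diagonal : ∀ j → sunAdj k hU (inj₁ (vertex j)) (inj₂ (vertex j)) ≡ true
    sun-diagonal j = ∨-trueˡ (dec-true (pos j ≟ pos j) refl)

    sun-step : ∀ j → sunAdj k hU (inj₁ (vertex (j + 1))) (inj₂ (vertex j)) ≡ true
    sun-step j = ∨-trueʳ (dec-true (_ ≟ _) (sym (next-pos j)))

    sun-gap : ∀ {i j} → pos i ≢ pos j → pos i ≢ pos (j + 1) →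
              sunAdj k hU (inj₁ (vertex i)) (inj₂ (vertex j)) ≡ false
    sun-gap {j = j} i≢j i≢j+1 =
      ∨-false (dec-false (_ ≟ _) i≢j) (dec-false (_ ≟ _) (λ e → i≢j+1 (trans e (next-pos j))))

  -- In C_k take a = v₂, b₁ = v₁, b₂ = v₃, c = v₀; k ≥ 5 makes v₃ ≁ v₀.

  hole-obstruction : 5 ≤ k → Obstruction (cycleAdj k) (vertex 2)
  hole-obstruction 5≤k = obstruction (vertex 1) (vertex 3) (vertex 0)
    (cycle-step-back 1) (cycle-step 2)
    (cycle-gap (s<s z<s) (≤-trans (s≤s (s≤s (s≤s (s≤s z≤n)))) 5≤k))
    (λ e → pos-injective z<s (≤-trans (s≤s (s≤s (s≤s z≤n))) 5≤k) (cong toℕ e))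
    (cycle-step-back 0)
    (cycle-gap (s<s z<s) 5≤k)

  module _ (3≤k : 3 ≤ k) (hU : Fin k → Fin k → Bool) where

    u₂≁w₀ : sunAdj k hU (inj₁ (vertex 2)) (inj₂ (vertex 0)) ≡ false
    u₂≁w₀ = sun-gap hU (pos-injective z<s 3≤k ∘ sym) (pos-injective (s<s z<s) (m≤n⇒m≤1+n 3≤k) ∘ sym)

    sun-obstruction-W : Obstruction (sunAdj k hU) (inj₂ (vertex 1))
    sun-obstruction-W = obstruction (inj₁ (vertex 1)) (inj₁ (vertex 2)) (inj₂ (vertex 0))
      (sun-diagonal hU 1) (sun-step hU 1) refl
      (λ e → pos-injective z<s (≤-trans (s≤s (s≤s z≤n)) 3≤k) (cong toℕ (inj₂-injective e)))
      (sun-step hU 0) u₂≁w₀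

    -- for u₁ the witness depends on whether u₁ ~ u₂
    sun-obstruction-U : Obstruction (sunAdj k hU) (inj₁ (vertex 1))
    sun-obstruction-U with hU (vertex 1) (vertex 2) in u₁u₂
    ... | false = obstruction (inj₂ (vertex 1)) (inj₂ (vertex 0)) (inj₁ (vertex 2))
      (sun-diagonal hU 1) (sun-step hU 0) u₁u₂
      (λ e → pos-injective (s<s z<s) (m≤n⇒m≤1+n 3≤k) (sym (cong toℕ (inj₁-injective e))))
      (sun-step hU 1) u₂≁w₀
    ... | true  = obstruction (inj₁ (vertex 2)) (inj₂ (vertex 1)) (inj₂ (vertex 2))
      u₁u₂ (sun-diagonal hU 1)
      (sun-gap hU (pos-injective (s<s z<s) (m≤n⇒m≤1+n 3≤k)) (pos-injective (s<s z<s) (s≤s 3≤k)))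
      (λ ()) (sun-diagonal hU 2) refl

walk-reaches : ∀ {k} .{{_ : NonZero k}} (a : Fin k) {s} → s ≤ k →
               CyclicWalk.vertex k (toℕ a + (k ∸ s)) s ≡ a
walk-reaches {k} a {s} s≤k = toℕ-injective (begin
  toℕ (CyclicWalk.vertex k y s)  ≡⟨ CyclicWalk.pos-residue k y s ⟩
  (toℕ a + (k ∸ s) + s) % k      ≡⟨ cong (_% k) (+-assoc (toℕ a) (k ∸ s) s) ⟩
  (toℕ a + (k ∸ s + s)) % k      ≡⟨ cong (λ m → (toℕ a + m) % k) (m∸n+n≡m s≤k) ⟩
  (toℕ a + k) % k                ≡⟨ [m+n]%n≡m%n (toℕ a) k ⟩
  toℕ a % k                      ≡⟨ m<n⇒m%n≡m (toℕ<n a) ⟩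
  toℕ a                          ∎)
  where
  open ≡-Reasoning
  y : ℕ
  y = toℕ a + (k ∸ s)

hole-obstructed : ∀ {k} .{{_ : NonZero k}} → 5 ≤ k → (a : Fin k) → Obstruction (cycleAdj k) a
hole-obstructed {k} 5≤k a =
  subst (Obstruction (cycleAdj k)) (walk-reaches a (≤-trans (s≤s (s≤s z≤n)) 5≤k))
        (CyclicWalk.hole-obstruction k (toℕ a + (k ∸ 2)) 5≤k)

sun-obstructed : ∀ {k} .{{_ : NonZero k}} → 3 ≤ k → (hU : Fin k → Fin k → Bool) →
                 (a : Fin k ⊎ Fin k) → Obstruction (sunAdj k hU) a
sun-obstructed {k} 3≤k hU (inj₁ a) =
  subst (Obstruction (sunAdj k hU) ∘ inj₁) (walk-reaches a (≤-trans (s≤s z≤n) 3≤k))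
        (CyclicWalk.sun-obstruction-U k (toℕ a + (k ∸ 1)) 3≤k hU)
sun-obstructed {k} 3≤k hU (inj₂ a) =
  subst (Obstruction (sunAdj k hU) ∘ inj₂) (walk-reaches a (≤-trans (s≤s z≤n) 3≤k))
        (CyclicWalk.sun-obstruction-W k (toℕ a + (k ∸ 1)) 3≤k hU)

-- Holes and suns are absent.
hole-free : (G : Graph) → ModuleComposed G → ∀ k → 5 ≤ k → ¬ ContainsInduced (cycleAdj k) G
hole-free G mc (suc p) 5≤k = obstructed-pattern-free G mc (maxima-Fin p) (hole-obstructed 5≤k)

sun-free : (G : Graph) → ModuleComposed G → ∀ k → 3 ≤ k → (hU : Fin k → Fin k → Bool) →
           ¬ ContainsInduced (sunAdj k hU) G
sun-free G mc (suc p) 3≤k hU =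
  obstructed-pattern-free G mc (maxima-⊎ (maxima-Fin p) (maxima-Fin p)) (sun-obstructed 3≤k hU)

lemma5 : (G : Graph) → ModuleComposed G → HHDSFree G
lemma5 G mc =
    obstructed-pattern-free G mc (maxima-Fin 4) house-obstructed
  , hole-free G mc
  , obstructed-pattern-free G mc (maxima-Fin 5) domino-obstructed
  , λ k 3≤k hU _ → sun-free G mc k 3≤k hU
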